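{- For every integer $n\ge 6$, $\left\lceil\frac{2n}{5}\right\rceil-1\le \iota_{\rm g}(P_n)\le \iota_{\rm g}'(P_n)\le \left\lfloor\frac{2n+2}{5}\right\rfloor$, where $P_n$ is the path on $n$ vertices.
   Context: All graphs are finite and simple; $N[S]$ denotes the closed neighborhood of a vertex set $S$. In the isolation game on a graph $G$, Dominator and Staller alternately choose vertices; if $S$ is the set of already chosen vertices, a vertex $x$ may be chosen only if it equals or is adjacent to some vertex $y$ lying in a component of $G-N[S]$ that has at least one edge. The game ends when no such vertex exists. Dominator wants to minimize the number of chosen vertices, Staller wants to maximize it. $\iota_{\rm g}(G)$ (resp. $\iota_{\rm g}'(G)$) is the number of chosen vertices under optimal play when Dominator (resp. Staller) moves first. -}

module Defs where

open import Data.Nat using (ℕ; zero; suc; _≤_)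
open import Data.Fin using (Fin; toℕ)
open import Data.List using (List; []; _∷_)
open import Data.List.Membership.Propositional using (_∈_)
open import Data.Product using (Σ; ∃; _×_; _,_)
open import Data.Sum using (_⊎_)
open import Data.Empty using (⊥)
open import Relation.Nullary using (¬_)
open import Relation.Binary.PropositionalEquality using (_≡_)

record Graph (n : ℕ) : Set₁ where
  field
    Adj     : Fin n → Fin n → Set
    sym     : ∀ {u v} → Adj u v → Adj v u
    irrefl  : ∀ {u} → ¬ Adj u u

open Graph public

PathAdj : ∀ {n} → Fin n → Fin n → Set
PathAdj i j = (toℕ j ≡ suc (toℕ i)) ⊎ (toℕ i ≡ suc (toℕ j))

path-sym : ∀ {n} {u v : Fin n} → PathAdj u v → PathAdj v u
path-sym (Data.Sum.inj₁ e) = Data.Sum.inj₂ e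
path-sym (Data.Sum.inj₂ e) = Data.Sum.inj₁ e

private
  n≢sn : ∀ {m : ℕ} → ¬ (m ≡ suc m)
  n≢sn {zero} ()
  n≢sn {suc m} e = n≢sn {m} (Data.Nat.Properties.suc-injective e)
    where import Data.Nat.Properties

path-irrefl : ∀ {n} {u : Fin n} → ¬ PathAdj u u
path-irrefl (Data.Sum.inj₁ e) = n≢sn e
path-irrefl (Data.Sum.inj₂ e) = n≢sn e

P : (n : ℕ) → Graph n
P n = record { Adj = PathAdj ; sym = path-sym ; irrefl = path-irrefl }

module _ {n : ℕ} (G : Graph n) where

  InClosedNbhd : List (Fin n) → Fin n → Set
  InClosedNbhd S v = ∃ λ s → s ∈ S × ((s ≡ v) ⊎ Adj G s v)

  Outside : List (Fin n) → Fin n → Set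
  Outside S v = ¬ InClosedNbhd S v

  data Reach (S : List (Fin n)) : Fin n → Fin n → Set where
    here : ∀ {u} → Outside S u → Reach S u u
    step : ∀ {u w v} → Outside S u → Adj G u w → Reach S w v → Reach S u v

  InEdgeComponent : List (Fin n) → Fin n → Set
  InEdgeComponent S y =
    Σ (Fin n) λ u → Σ (Fin n) λ v →
      Reach S y u × Outside S u × Outside S v × Adj G u v

  Legal : List (Fin n) → Fin n → Set
  Legal S x = ∃ λ y → InEdgeComponent S y × ((x ≡ y) ⊎ Adj G x y)

  data Player : Set where
    dominator staller : Player

  other : Player → Player
  other dominator = staller
  other staller = dominator

  Prefers : Player → ℕ → ℕ → Set
  Prefers dominator a b = a ≤ b
  Prefers staller   a b = b ≤ a

  -- GameValue f p S k : with p to move, S already chosen, the number of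
  -- vertices still to be chosen under optimal play is k (minimax value),
  -- computed with recursion depth bound f (f = n+1 suffices, since every
  -- legal move is a new vertex, so at most n moves are ever made).
  GameValue : ℕ → Player → List (Fin n) → ℕ → Set
  GameValue zero p S k = ⊥
  GameValue (suc f) p S k =
    ((∀ x → ¬ Legal S x) × (k ≡ 0))
    ⊎ (Σ (Fin n) λ x → Legal S x × Σ ℕ λ k′ → (k ≡ suc k′)
        × GameValue f (other p) (x ∷ S) k′
        × (∀ y → Legal S y → ∀ m → GameValue f (other p) (y ∷ S) m → Prefers p k′ m))

  IsIotaG : ℕ → Set
  IsIotaG k = GameValue (suc n) dominator [] k

  IsIotaG′ : ℕ → Set
  IsIotaG′ k = GameValue (suc n) staller [] k

{-# OPTIONS --safe #-}
module Submission where

-- Weigh a path on L vertices by w L (weight below; it grows by 16 every five vertices) and a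
-- position S of the game on P_n by its potential Z, the sum of w over the components of
-- P_n − N[S]. A move at the j-th vertex of a component with L ≥ 2 vertices leaves components
-- with j − 2 and L − j − 1 vertices, which lowers Z by between 1 and 15. A power of two 2^e
-- dividing w L measures what each player can force on that component: Dominator can lower Z by
-- 16 − 2^e, and Staller, playing on a dominated end vertex of the component, by at most 2^e. On
-- the component with the least e, 2^e divides every weight and hence Z, and then these bounds say
-- that Dominator can push ⌈Z′/8⌉ below ⌊Z/8⌋ while Staller can keep ⌊Z′/8⌋ + 1 ≥ ⌈Z/8⌉. By
-- induction the game value is ⌊Z/8⌋ with Dominator to move and ⌈Z/8⌉ with Staller to move (once
-- a vertex has been chosen). So ι_g(P_n) = ⌊w n / 8⌋, ι_g′(P_n) is one more than the best ⌊Z/8⌋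
-- that Staller's first move can leave, and the stated bounds are arithmetic on w.

open import Defs hiding (sym)
open import Data.Nat
open import Data.Nat.Properties
open import Data.Nat.DivMod using (_/_; _%_; m≡m%n+[m/n]*n; m%n<n; m/n*n≤m; m*n/n≡m; /-monoˡ-≤; m<n*o⇒m/o<n; +-distrib-/-∣ˡ)
open import Data.Nat.Divisibility using (_∣_; _∣?_; divides; _∣0; ∣m∣n⇒∣m+n; m∣m*n; n∣m*n; ∣-trans)
open import Data.Nat.ListAction using (sum)
open import Data.Nat.ListAction.Properties using (sum-++)
open import Data.Nat.Tactic.RingSolver using (solve-∀)
open import Data.Bool using (Bool; true; false; _∨_)
open import Data.Bool.Properties using (∨-zeroʳ; ∨-identityʳ)
open import Data.Fin using (Fin; toℕ; fromℕ<)
open import Data.Fin.Properties using (toℕ<n; toℕ-fromℕ<; toℕ-injective)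
open import Data.List using (List; []; _∷_; _++_; replicate; map)
open import Data.List.Properties using (map-++)
open import Data.List.Membership.Propositional using (_∈_)
open import Data.List.Relation.Unary.Any using (here; there)
open import Data.List.Relation.Unary.All as All using (All; []; _∷_)
open import Data.List.Extrema.Nat using (argmin; argmin-sel; f[argmin]≤f[xs])
open import Data.Product using (Σ; _×_; _,_; proj₁; proj₂)
open import Data.Sum as Sum using (_⊎_; inj₁; inj₂)
open import Data.Unit using (⊤; tt)
open import Data.Empty using (⊥-elim)
open import Function using (_∘_; case_of_)
open import Relation.Nullary using (¬_; yes; no; contradiction)
open import Relation.Nullary.Decidable using (True; toWitness; _×-dec_; _→-dec_; _⊎-dec_)
open import Relation.Unary using (Decidable)
open import Relation.Binary.PropositionalEquality

-- Weights of paths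

weight : ℕ → ℕ
weight 0 = 0
weight 1 = 0
weight 2 = 8
weight 3 = 12
weight 4 = 14
weight 5 = 15
weight 6 = 16
weight (suc (suc (suc (suc (suc (suc (suc k))))))) = 16 + weight (suc (suc k))

-- weight (7 + k) = 16 + weight (2 + k), so facts about weight are evaluated on 0, …, 6 and propagated.
module _ {Q : ℕ → Set} where

  periodic : (∀ {L} → L < 7 → Q L) → (∀ {k} → Q (2 + k) → Q (7 + k)) → ∀ L → Q L
  periodic base period 0 = base (m≤m+n _ _)
  periodic base period 1 = base (m≤m+n _ _)
  periodic base period 2 = base (m≤m+n _ _)
  periodic base period 3 = base (m≤m+n _ _)
  periodic base period 4 = base (m≤m+n _ _)
  periodic base period 5 = base (m≤m+n _ _)
  periodic base period 6 = base (m≤m+n _ _)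
  periodic base period (suc (suc (suc (suc (suc (suc (suc k))))))) = period (periodic base period (suc (suc k)))

  below7 : (Q? : Decidable Q) → {True (allUpTo? Q? 7)} → ∀ {L} → L < 7 → Q L
  below7 Q? {ok} = toWitness ok

infix 4 _⋖_
_⋖_ : ℕ → ℕ → Set
x ⋖ y = x < y × y ≤ x + 15

⋖-shift : ∀ {x y} → x ⋖ y → 16 + x ⋖ 16 + y
⋖-shift (x<y , y≤x+15) = +-monoʳ-< 16 x<y , +-monoʳ-≤ 16 y≤x+15

weight-suc : ∀ L → 1 ≤ L → weight L ⋖ weight (1 + L)
weight-suc = periodic (below7 λ L → 1 ≤? L →-dec (weight L <? weight (1 + L) ×-dec weight (1 + L) ≤? weight L + 15))
  λ h _ → ⋖-shift (h (s≤s z≤n))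

weight-suc-suc : ∀ L → weight L ⋖ weight (2 + L)
weight-suc-suc = periodic (below7 λ L → weight L <? weight (2 + L) ×-dec weight (2 + L) ≤? weight L + 15) ⋖-shift

weight-split : ∀ a b → weight a + weight b ⋖ weight (3 + a + b)
weight-split = periodic {Q = λ a → ∀ b → Split a b} (λ {a} a<7 → periodic (table a<7) (shift {a})) (λ h b → ⋖-shift (h b))
  where
  Split : ℕ → ℕ → Set
  Split a b = weight a + weight b ⋖ weight (3 + a + b)

  table : ∀ {a} → a < 7 → ∀ {b} → b < 7 → Split a b
  table = below7 λ a → allUpTo? (λ b → weight a + weight b <? weight (3 + a + b) ×-dec weight (3 + a + b) ≤? weight a + weight b + 15) 7

  shift : ∀ {a k} → Split a (2 + k) → Split a (7 + k)
  shift {a} {k} h = subst₂ _⋖_ (move16 (weight a) (weight (2 + k))) (cong weight (reorder a k)) (⋖-shift h)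
    where
    move16 : ∀ x y → 16 + (x + y) ≡ x + (16 + y)
    move16 = solve-∀
    reorder : ∀ a k → 5 + (3 + a + (2 + k)) ≡ 3 + a + (7 + k)
    reorder = solve-∀

weight-drop : ∀ L j → 2 ≤ L → j ≤ suc L → weight (j ∸ 2) + weight (L ∸ suc j) ⋖ weight L
weight-drop (suc L) 0 (s≤s 1≤L) _ = weight-suc L 1≤L
weight-drop 1 1 (s≤s ()) _
weight-drop (suc (suc L)) 1 _ _ = weight-suc-suc L
weight-drop L (suc (suc t)) 2≤L j≤1+L with 3 + t ≤? L
... | yes 3+t≤L = subst (λ M → weight t + weight (L ∸ (3 + t)) ⋖ weight M) (m+[n∸m]≡n 3+t≤L) (weight-split t (L ∸ (3 + t)))
... | no 3+t≰L rewrite m≤n⇒m∸n≡0 (<⇒≤ (≰⇒> 3+t≰L)) | +-identityʳ (weight t)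
      with m≤n⇒m<n∨m≡n (≤-pred (≰⇒> 3+t≰L))
...   | inj₂ refl = weight-suc-suc t
...   | inj₁ L<2+t rewrite ≤-antisym (≤-pred L<2+t) (≤-pred j≤1+L) = weight-suc t (≤-pred 2≤L)

-- On a component with L ≥ 2 vertices Dominator can lower the potential by 16 − 2 ^ domExp L and
-- Staller by as little as 2 ^ stalExp L; components without an edge get the exponent 4.
domExp stalExp : ℕ → ℕ
domExp 0 = 4
domExp 1 = 4
domExp 2 = 3
domExp 3 = 2
domExp 4 = 1
domExp 5 = 0
domExp 6 = 3
domExp (suc (suc (suc (suc (suc (suc (suc k))))))) = domExp (suc (suc k))
stalExp 0 = 4
stalExp 1 = 4
stalExp 2 = 3
stalExp 3 = 2
stalExp 4 = 1
stalExp 5 = 0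
stalExp 6 = 0
stalExp (suc (suc (suc (suc (suc (suc (suc k))))))) = stalExp (suc (suc k))

2^-∣ : ∀ {m n} → m ≤ n → 2 ^ m ∣ 2 ^ n
2^-∣ {m} {n} m≤n = subst (2 ^ m ∣_) split (m∣m*n (2 ^ (n ∸ m)))
  where
  split : 2 ^ m * 2 ^ (n ∸ m) ≡ 2 ^ n
  split = trans (sym (^-distribˡ-+-* 2 m (n ∸ m))) (cong (2 ^_) (m+[n∸m]≡n m≤n))

∣16+ : ∀ {e w} → e ≤ 3 → 2 ^ e ∣ w → 2 ^ e ∣ 16 + w
∣16+ e≤3 = ∣m∣n⇒∣m+n (2^-∣ (≤-trans e≤3 (n≤1+n 3)))

long⇒domExp≤3 : ∀ L → 2 ≤ L → domExp L ≤ 3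
long⇒domExp≤3 = periodic (below7 λ L → 2 ≤? L →-dec domExp L ≤? 3) λ h _ → h (s≤s (s≤s z≤n))

long⇒stalExp≤3 : ∀ L → 2 ≤ L → stalExp L ≤ 3
long⇒stalExp≤3 = periodic (below7 λ L → 2 ≤? L →-dec stalExp L ≤? 3) λ h _ → h (s≤s (s≤s z≤n))

domExp≤3⇒long : ∀ L → domExp L ≤ 3 → 2 ≤ L
domExp≤3⇒long 0 (s≤s (s≤s (s≤s ())))
domExp≤3⇒long 1 (s≤s (s≤s (s≤s ())))
domExp≤3⇒long (suc (suc _)) _ = s≤s (s≤s z≤n)

stalExp≤3⇒long : ∀ L → stalExp L ≤ 3 → 2 ≤ L
stalExp≤3⇒long 0 (s≤s (s≤s (s≤s ())))
stalExp≤3⇒long 1 (s≤s (s≤s (s≤s ())))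
stalExp≤3⇒long (suc (suc _)) _ = s≤s (s≤s z≤n)

2^domExp∣weight : ∀ L → 2 ^ domExp L ∣ weight L
2^domExp∣weight = periodic (below7 λ L → 2 ^ domExp L ∣? weight L) λ {k} → ∣16+ (long⇒domExp≤3 (2 + k) (s≤s (s≤s z≤n)))

2^stalExp∣weight : ∀ L → 2 ^ stalExp L ∣ weight L
2^stalExp∣weight = periodic (below7 λ L → 2 ^ stalExp L ∣? weight L) λ {k} → ∣16+ (long⇒stalExp≤3 (2 + k) (s≤s (s≤s z≤n)))

dominator-drop : ∀ L → 2 ≤ L → weight (L ⊓ 3 ∸ 2) + weight (L ∸ suc (L ⊓ 3)) + 16 ≤ weight L + 2 ^ domExp L
dominator-drop 1 (s≤s ())
dominator-drop 2 _ = ≤-refl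
dominator-drop 3 _ = ≤-refl
dominator-drop (suc (suc (suc (suc m)))) _ = periodic {Q = λ m → weight m + 16 ≤ weight (4 + m) + 2 ^ domExp (4 + m)}
  (below7 λ m → weight m + 16 ≤? weight (4 + m) + 2 ^ domExp (4 + m)) (+-monoʳ-≤ 16) m

staller-drop : ∀ L → 2 ≤ L → weight L ≤ weight (L ∸ 1) + 2 ^ stalExp L
staller-drop (suc m) (s≤s 1≤m) = periodic {Q = λ m → 1 ≤ m → weight (1 + m) ≤ weight m + 2 ^ stalExp (1 + m)}
  (below7 λ m → 1 ≤? m →-dec weight (1 + m) ≤? weight m + 2 ^ stalExp (1 + m)) (λ h _ → +-monoʳ-≤ 16 (h (s≤s z≤n))) m 1≤m

short-weight : ∀ L → L < 2 → weight L ≡ 0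
short-weight 0 _ = refl
short-weight 1 _ = refl
short-weight (suc (suc _)) (s≤s (s≤s ()))

sum-map-zero : ∀ {f : ℕ → ℕ} {xs} → All (λ x → f x ≡ 0) xs → sum (map f xs) ≡ 0
sum-map-zero [] = refl
sum-map-zero (fx≡0 ∷ rest) = cong₂ _+_ fx≡0 (sum-map-zero rest)

∣-sum-map : ∀ {d} {f : ℕ → ℕ} {xs} → All (λ x → d ∣ f x) xs → d ∣ sum (map f xs)
∣-sum-map [] = _ ∣0
∣-sum-map (d∣fx ∷ rest) = ∣m∣n⇒∣m+n d∣fx (∣-sum-map rest)

record WeightExponent (e : ℕ → ℕ) : Set where
  field
    2^e∣weight : ∀ L → 2 ^ e L ∣ weight L
    long⇒e≤3   : ∀ L → 2 ≤ L → e L ≤ 3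
    e≤3⇒long   : ∀ L → e L ≤ 3 → 2 ≤ L

domExp-exponent : WeightExponent domExp
domExp-exponent = record { 2^e∣weight = 2^domExp∣weight ; long⇒e≤3 = long⇒domExp≤3 ; e≤3⇒long = domExp≤3⇒long }

stalExp-exponent : WeightExponent stalExp
stalExp-exponent = record { 2^e∣weight = 2^stalExp∣weight ; long⇒e≤3 = long⇒stalExp≤3 ; e≤3⇒long = stalExp≤3⇒long }

-- Powers of two are totally ordered by divisibility, so the least one divides all the weights.
least-exponent : ∀ {e} → WeightExponent e → ∀ R →
  sum (map weight R) ≡ 0 ⊎ Σ ℕ λ L → L ∈ R × 2 ≤ L × 2 ^ e L ∣ sum (map weight R)
least-exponent {e} exponent R = pick (argmin e 0 R) (argmin-sel e 0 R) (f[argmin]≤f[xs] 0 R)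
  where
  open WeightExponent exponent
  pick : ∀ m → m ≡ 0 ⊎ m ∈ R → All (λ L → e m ≤ e L) R →
         sum (map weight R) ≡ 0 ⊎ Σ ℕ λ L → L ∈ R × 2 ≤ L × 2 ^ e L ∣ sum (map weight R)
  pick m m∈R least with e m ≤? 3 | m∈R
  ... | yes small | inj₁ refl = contradiction (e≤3⇒long 0 small) λ ()
  ... | yes small | inj₂ m∈R = inj₂ (m , m∈R , e≤3⇒long m small ,
          ∣-sum-map (All.map (λ {L} e≤ → ∣-trans (2^-∣ e≤) (2^e∣weight L)) least))
  ... | no big | _ =
    inj₁ (sum-map-zero (All.map (λ {L} e≤ → short-weight L (≰⇒> λ 2≤L → big (≤-trans e≤ (long⇒e≤3 L 2≤L)))) least))

-- Potential drops and eighths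

⌈_/8⌉ : ℕ → ℕ
⌈ Z /8⌉ = (7 + Z) / 8

≤/ : ∀ {c Z d} .{{_ : NonZero d}} → c * d ≤ Z → c ≤ Z / d
≤/ {c} {Z} {d} c*d≤Z = subst (_≤ Z / d) (m*n/n≡m c d) (/-monoˡ-≤ d c*d≤Z)

/8≤ : ∀ {c Z} → Z < suc c * 8 → Z / 8 ≤ c
/8≤ Z<[1+c]*8 = ≤-pred (m<n*o⇒m/o<n Z<[1+c]*8)

<[/8+1]*8 : ∀ Z → Z < suc (Z / 8) * 8
<[/8+1]*8 Z = begin-strict
  Z                   ≡⟨ m≡m%n+[m/n]*n Z 8 ⟩
  Z % 8 + (Z / 8) * 8 <⟨ +-monoˡ-< ((Z / 8) * 8) (m%n<n Z 8) ⟩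
  suc (Z / 8) * 8     ∎
  where open ≤-Reasoning

≤⌈/8⌉*8 : ∀ Z → Z ≤ ⌈ Z /8⌉ * 8
≤⌈/8⌉*8 Z = +-cancelˡ-≤ 7 _ _ (≤-pred (<[/8+1]*8 (7 + Z)))

∣-spacing : ∀ {m a b} → m ∣ a → m ∣ b → a < b → a + m ≤ b
∣-spacing {m} (divides x refl) (divides y refl) xm<ym =
  subst (_≤ y * m) (+-comm m (x * m)) (*-monoˡ-≤ m (*-cancelʳ-< _ x y xm<ym))

∣8⇒∣[1+c]*8 : ∀ {m} c → m ∣ 8 → m ∣ suc c * 8
∣8⇒∣[1+c]*8 c m∣8 = ∣m∣n⇒∣m+n m∣8 (∣-trans m∣8 (n∣m*n c))

any-move-ceil : ∀ {Z Z′} → Z′ < Z → suc (Z′ / 8) ≤ ⌈ Z /8⌉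
any-move-ceil {Z} {Z′} Z′<Z = ≤/ (begin
  suc (Z′ / 8) * 8  ≡⟨⟩
  8 + (Z′ / 8) * 8  ≤⟨ +-monoʳ-≤ 8 (m/n*n≤m Z′ 8) ⟩
  8 + Z′            ≤⟨ +-monoʳ-≤ 7 Z′<Z ⟩
  7 + Z             ∎)
  where open ≤-Reasoning

any-move-floor : ∀ {Z Z′} → Z ≤ Z′ + 15 → Z / 8 ≤ suc ⌈ Z′ /8⌉
any-move-floor {Z} {Z′} Z≤Z′+15 = /8≤ (begin-strict
  Z                      ≤⟨ Z≤Z′+15 ⟩
  Z′ + 15                ≤⟨ +-monoˡ-≤ 15 (≤⌈/8⌉*8 Z′) ⟩
  ⌈ Z′ /8⌉ * 8 + 15      <⟨ +-monoʳ-< (⌈ Z′ /8⌉ * 8) (n<1+n 15) ⟩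
  ⌈ Z′ /8⌉ * 8 + 16      ≡⟨ +-comm (⌈ Z′ /8⌉ * 8) 16 ⟩
  suc (suc ⌈ Z′ /8⌉) * 8 ∎)
  where open ≤-Reasoning

good-dominator-move : ∀ {m Z Z′} → m ∣ 8 → m ∣ Z → Z′ + 16 ≤ Z + m → suc ⌈ Z′ /8⌉ ≤ Z / 8
good-dominator-move {m} {Z} {Z′} m∣8 m∣Z drop = m<n*o⇒m/o<n (+-cancelˡ-≤ 8 _ _ (begin
  8 + suc (7 + Z′)   ≡⟨ +-comm 16 Z′ ⟩
  Z′ + 16            ≤⟨ drop ⟩
  Z + m              ≤⟨ ∣-spacing m∣Z (∣8⇒∣[1+c]*8 (Z / 8) m∣8) (<[/8+1]*8 Z) ⟩
  8 + (Z / 8) * 8    ∎))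
  where open ≤-Reasoning

good-staller-move : ∀ {m Z Z′} → m ∣ 8 → m ∣ Z → Z ≤ Z′ + m → ⌈ Z /8⌉ ≤ suc (Z′ / 8)
good-staller-move {m} {Z} {Z′} m∣8 m∣Z drop = /8≤ (+-monoʳ-≤ 8 Z≤c*8)
  where
  c*8 : ℕ
  c*8 = suc (Z′ / 8) * 8
  Z≤c*8 : Z ≤ c*8
  Z≤c*8 = ≮⇒≥ λ c*8<Z →
    <⇒≱ (+-monoˡ-< m (<[/8+1]*8 Z′)) (≤-trans (∣-spacing (∣8⇒∣[1+c]*8 (Z′ / 8) m∣8) m∣Z c*8<Z) drop)

trade : ∀ {x y a b k m} → x + a ≡ y + b → b + k ≤ a + m → x + k ≤ y + m
trade {x} {y} {a} {b} {k} {m} x+a≡y+b b+k≤a+m = +-cancelʳ-≤ b (x + k) (y + m) (begin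
  x + k + b   ≡⟨ trans (+-assoc x k b) (cong (x +_) (+-comm k b)) ⟩
  x + (b + k) ≤⟨ +-monoʳ-≤ x b+k≤a+m ⟩
  x + (a + m) ≡⟨ sym (+-assoc x a m) ⟩
  x + a + m   ≡⟨ cong (_+ m) x+a≡y+b ⟩
  y + b + m   ≡⟨ trans (+-assoc y b m) (trans (cong (y +_) (+-comm b m)) (sym (+-assoc y m b))) ⟩
  y + m + b   ∎)
  where open ≤-Reasoning

trade-< : ∀ {x y a b} → x + a ≡ y + b → b < a → x < y
trade-< {x} {y} {a} {b} x+a≡y+b b<a =
  subst₂ _≤_ (+-comm x 1) (+-identityʳ y) (trade {k = 1} {m = 0} x+a≡y+b (subst₂ _≤_ (+-comm 1 b) (sym (+-identityʳ a)) b<a))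

trade-≤ : ∀ {x y a b k} → x + a ≡ y + b → a ≤ b + k → y ≤ x + k
trade-≤ {x} {y} {a} {b} {k} x+a≡y+b a≤b+k =
  subst (_≤ x + k) (+-identityʳ y) (trade {k = 0} {m = k} (sym x+a≡y+b) (subst (_≤ b + k) (sym (+-identityʳ a)) a≤b+k))

trade-⋖ : ∀ {x y a b} → x + a ≡ y + b → b ⋖ a → x ⋖ y
trade-⋖ x+a≡y+b (b<a , a≤b+15) = trade-< x+a≡y+b b<a , trade-≤ x+a≡y+b a≤b+15

split-shrinks : ∀ {L j} → 1 ≤ L → j ≤ suc L → j ∸ 2 + (L ∸ suc j) < L
split-shrinks {L} {j} 1≤L j≤1+L with suc j ≤? L
... | yes 1+j≤L = begin-strict
  j ∸ 2 + (L ∸ suc j)   ≤⟨ +-monoˡ-≤ (L ∸ suc j) (m∸n≤m j 2) ⟩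
  j + (L ∸ suc j)       <⟨ n<1+n _ ⟩
  suc j + (L ∸ suc j)   ≡⟨ m+[n∸m]≡n 1+j≤L ⟩
  L                     ∎
  where open ≤-Reasoning
... | no 1+j≰L rewrite m≤n⇒m∸n≡0 (<⇒≤ (≰⇒> 1+j≰L)) | +-identityʳ (j ∸ 2) =
  ≤-trans (s≤s (∸-monoˡ-≤ 2 j≤1+L)) (≤-reflexive (suc-pred L ⦃ >-nonZero 1≤L ⦄))

-- With vertices counted from 0, P_n − N[t] consists of paths on t − 1 and n − t − 2 vertices.
opening : ℕ → ℕ → ℕ
opening n t = weight (t ∸ 1) + weight (n ∸ suc (suc t))

+16/8 : ∀ x → (16 + x) / 8 ≡ 2 + x / 8
+16/8 x = +-distrib-/-∣ˡ {16} x {8} (divides 2 refl)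

[5+m]/5 : ∀ m c → (2 * (5 + m) + c) / 5 ≡ 2 + (2 * m + c) / 5
[5+m]/5 m c = trans (cong (_/ 5) (shift m c)) (+-distrib-/-∣ˡ {10} (2 * m + c) {5} (divides 2 refl))
  where
  shift : ∀ m c → 2 * (5 + m) + c ≡ 10 + (2 * m + c)
  shift = solve-∀

weight-lower : ∀ n → (2 * n + 4) / 5 ∸ 1 ≤ weight n / 8
weight-lower = periodic (below7 λ n → (2 * n + 4) / 5 ∸ 1 ≤? weight n / 8) λ {k} → five-more {k}
  where
  five-more : ∀ {k} → (2 * (2 + k) + 4) / 5 ∸ 1 ≤ weight (2 + k) / 8 → (2 * (7 + k) + 4) / 5 ∸ 1 ≤ weight (7 + k) / 8
  five-more {k} h = subst₂ (λ a b → a ∸ 1 ≤ b) (sym ([5+m]/5 (2 + k) 4)) (sym (+16/8 (weight (2 + k))))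
    (s≤s (≤-trans (m≤n+m∸n _ 1) (s≤s h)))

weight-upper : ∀ n → weight n / 8 ≤ (2 * n + 2) / 5
weight-upper = periodic (below7 λ n → weight n / 8 ≤? (2 * n + 2) / 5) λ {k} → five-more {k}
  where
  five-more : ∀ {k} → weight (2 + k) / 8 ≤ (2 * (2 + k) + 2) / 5 → weight (7 + k) / 8 ≤ (2 * (7 + k) + 2) / 5
  five-more {k} h = subst₂ _≤_ (sym (+16/8 (weight (2 + k)))) (sym ([5+m]/5 (2 + k) 2)) (+-monoʳ-≤ 2 h)

staller-opening : ∀ m → 1 ≤ m →
  (2 * (5 + m) + 2) / 5 ≤ suc (weight (3 + m) / 8) ⊎ (2 * (5 + m) + 2) / 5 ≤ suc ((8 + weight m) / 8)
staller-opening = periodic {Q = Opening}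
  (below7 λ m → 1 ≤? m →-dec ((2 * (5 + m) + 2) / 5 ≤? suc (weight (3 + m) / 8) ⊎-dec
                               (2 * (5 + m) + 2) / 5 ≤? suc ((8 + weight m) / 8)))
  λ {k} → five-more {k}
  where
  Opening : ℕ → Set
  Opening m = 1 ≤ m → (2 * (5 + m) + 2) / 5 ≤ suc (weight (3 + m) / 8) ⊎ (2 * (5 + m) + 2) / 5 ≤ suc ((8 + weight m) / 8)
  shift : ∀ {k w} → (2 * (5 + (2 + k)) + 2) / 5 ≤ suc (w / 8) → (2 * (5 + (7 + k)) + 2) / 5 ≤ suc ((16 + w) / 8)
  shift {k} {w} h = subst₂ _≤_ (sym ([5+m]/5 (7 + k) 2)) (cong suc (sym (+16/8 w))) (+-monoʳ-≤ 2 h)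
  five-more : ∀ {k} → Opening (2 + k) → Opening (7 + k)
  five-more {k} h _ = Sum.map (shift {k} {weight (5 + k)}) (shift {k} {8 + weight (2 + k)}) (h (s≤s z≤n))

weight-linear : ∀ L → weight L * 5 ≤ L * 16 + 12
weight-linear = periodic (below7 λ L → weight L * 5 ≤? L * 16 + 12) (+-monoʳ-≤ 80)

staller-opening-bound : ∀ Z n → Z * 5 + 20 ≤ n * 16 → suc (Z / 8) ≤ (2 * n + 2) / 5
staller-opening-bound Z n h = ≤/ (begin
  suc Q * 5       ≡⟨ trans (+-comm 5 (Q * 5)) (sym (+-assoc (Q * 5) 3 2)) ⟩
  Q * 5 + 3 + 2   ≤⟨ +-monoˡ-≤ 2 (≤-pred (*-cancelʳ-< _ _ _ 8-fold)) ⟩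
  2 * n + 2       ∎)
  where
  open ≤-Reasoning
  Q : ℕ
  Q = Z / 8
  8-fold : (Q * 5 + 3) * 8 < (1 + 2 * n) * 8
  8-fold = begin-strict
    (Q * 5 + 3) * 8   ≡⟨ e₁ Q ⟩
    Q * 8 * 5 + 24    ≤⟨ +-monoˡ-≤ 24 (*-monoˡ-≤ 5 (m/n*n≤m Z 8)) ⟩
    Z * 5 + 24        ≡⟨ sym (+-assoc (Z * 5) 20 4) ⟩
    Z * 5 + 20 + 4    ≤⟨ +-monoˡ-≤ 4 h ⟩
    n * 16 + 4        <⟨ +-monoʳ-< (n * 16) (s≤s (s≤s (s≤s (s≤s (s≤s z≤n))))) ⟩
    n * 16 + 8        ≡⟨ e₂ n ⟩
    (1 + 2 * n) * 8   ∎
    where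
    e₁ : ∀ Q → (Q * 5 + 3) * 8 ≡ Q * 8 * 5 + 24
    e₁ = solve-∀
    e₂ : ∀ n → n * 16 + 8 ≡ (1 + 2 * n) * 8
    e₂ = solve-∀

opening-weight : ∀ n t → 2 ≤ n → t < n → opening n t * 5 + 20 ≤ n * 16
opening-weight 1 zero (s≤s ()) _
opening-weight (suc (suc m)) zero _ _ = single m
  where
  single : ∀ m → weight m * 5 + 20 ≤ (2 + m) * 16
  single m = ≤-trans (+-monoˡ-≤ 20 (weight-linear m)) (≤-reflexive (e m))
    where
    e : ∀ m → m * 16 + 12 + 20 ≡ (2 + m) * 16
    e = solve-∀
opening-weight n (suc t) _ t<n with 3 + t ≤? n
... | yes 3+t≤n = subst (λ N → (weight t + weight (n ∸ (3 + t))) * 5 + 20 ≤ N * 16) (m+[n∸m]≡n 3+t≤n) (pair t (n ∸ (3 + t)))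
  where
  pair : ∀ a b → (weight a + weight b) * 5 + 20 ≤ (3 + a + b) * 16
  pair a b = begin
    (weight a + weight b) * 5 + 20  ≡⟨ cong (_+ 20) (*-distribʳ-+ 5 (weight a) (weight b)) ⟩
    weight a * 5 + weight b * 5 + 20 ≤⟨ +-monoˡ-≤ 20 (+-mono-≤ (weight-linear a) (weight-linear b)) ⟩
    a * 16 + 12 + (b * 16 + 12) + 20 ≤⟨ m≤m+n _ 4 ⟩
    a * 16 + 12 + (b * 16 + 12) + 20 + 4 ≡⟨ e a b ⟩
    (3 + a + b) * 16                 ∎
    where
    open ≤-Reasoning
    e : ∀ a b → a * 16 + 12 + (b * 16 + 12) + 20 + 4 ≡ (3 + a + b) * 16
    e = solve-∀
... | no 3+t≰n rewrite ≤-antisym (≤-pred (≰⇒> 3+t≰n)) t<n | m≤n⇒m∸n≡0 (n≤1+n (suc (suc t))) | +-identityʳ (weight t) =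
  opening-weight (suc (suc t)) zero (s≤s (s≤s z≤n)) (s≤s z≤n)

opening-bound : ∀ n t → 2 ≤ n → t < n → suc (opening n t / 8) ≤ (2 * n + 2) / 5
opening-bound n t 2≤n t<n = staller-opening-bound (opening n t) n (opening-weight n t 2≤n t<n)

-- Staller opens on an end vertex, or on the fourth vertex when n ≡ 2 (mod 5).
best-opening : ∀ n → 6 ≤ n → Σ ℕ λ t → t < n × (2 * n + 2) / 5 ≤ suc (opening n t / 8)
best-opening n 6≤n = subst (λ N → Σ ℕ λ t → t < N × (2 * N + 2) / 5 ≤ suc (opening N t / 8)) (m+[n∸m]≡n 5≤n)
  (pick (staller-opening (n ∸ 5) (∸-monoˡ-≤ 5 6≤n)))
  where
  5≤n : 5 ≤ n
  5≤n = ≤-trans (n≤1+n 5) 6≤n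
  pick : ∀ {m} → (2 * (5 + m) + 2) / 5 ≤ suc (weight (3 + m) / 8) ⊎ (2 * (5 + m) + 2) / 5 ≤ suc ((8 + weight m) / 8) →
         Σ ℕ λ t → t < 5 + m × (2 * (5 + m) + 2) / 5 ≤ suc (opening (5 + m) t / 8)
  pick (inj₁ via-end) = 0 , s≤s z≤n , via-end
  pick (inj₂ via-third) = 3 , s≤s (s≤s (s≤s (s≤s z≤n))) , via-third

-- Blocks of free cells in a Boolean board

segment : (ℕ → Bool) → ℕ → ℕ → List Bool
segment d i zero = []
segment d i (suc m) = d i ∷ segment d (suc i) m

runs : List Bool → ℕ → List ℕ
runs [] k = k ∷ []
runs (true ∷ l) k = k ∷ runs l 0
runs (false ∷ l) k = runs l (suc k)

HeadTrue : List Bool → Set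
HeadTrue [] = ⊤
HeadTrue (b ∷ _) = b ≡ true

near : ℕ → ℕ → Bool
near X t = (X ≡ᵇ t) ∨ (suc X ≡ᵇ t) ∨ (X ≡ᵇ suc t)

near-sound : ∀ a b → near a b ≡ true → a ≡ b ⊎ b ≡ suc a ⊎ a ≡ suc b
near-sound zero zero _ = inj₁ refl
near-sound zero (suc zero) _ = inj₂ (inj₁ refl)
near-sound (suc zero) zero _ = inj₂ (inj₂ refl)
near-sound (suc a) (suc b) e with near-sound a b e
... | inj₁ refl = inj₁ refl
... | inj₂ (inj₁ refl) = inj₂ (inj₁ refl)
... | inj₂ (inj₂ refl) = inj₂ (inj₂ refl)

near-complete : ∀ a b → a ≡ b ⊎ b ≡ suc a ⊎ a ≡ suc b → near a b ≡ true
near-complete zero _ (inj₁ refl) = refl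
near-complete zero _ (inj₂ (inj₁ refl)) = refl
near-complete (suc zero) _ (inj₂ (inj₂ refl)) = refl
near-complete (suc (suc a)) zero (inj₂ (inj₂ ()))
near-complete (suc a) (suc b) rel = near-complete a b (lower rel)
  where
  lower : suc a ≡ suc b ⊎ suc b ≡ suc (suc a) ⊎ suc a ≡ suc (suc b) → a ≡ b ⊎ b ≡ suc a ⊎ a ≡ suc b
  lower (inj₁ refl) = inj₁ refl
  lower (inj₂ (inj₁ refl)) = inj₂ (inj₁ refl)
  lower (inj₂ (inj₂ refl)) = inj₂ (inj₂ refl)

runs-++-true : ∀ A B k → runs (A ++ true ∷ B) k ≡ runs A k ++ runs B 0
runs-++-true [] B k = refl
runs-++-true (true ∷ A) B k = cong (k ∷_) (runs-++-true A B 0)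
runs-++-true (false ∷ A) B k = runs-++-true A B (suc k)

runs-replicate : ∀ L C k → runs (replicate L false ++ C) k ≡ runs C (L + k)
runs-replicate zero C k = refl
runs-replicate (suc L) C k = trans (runs-replicate L C (suc k)) (cong (runs C) (+-suc L k))

segment-++ : ∀ d i a b → segment d i (a + b) ≡ segment d i a ++ segment d (i + a) b
segment-++ d i zero b = cong (λ j → segment d j b) (sym (+-identityʳ i))
segment-++ d i (suc a) b =
  cong (d i ∷_) (trans (segment-++ d (suc i) a b) (cong (λ j → segment d (suc i) a ++ segment d j b) (sym (+-suc i a))))

segment-cong : ∀ {f g} i m → (∀ t → i ≤ t → t < i + m → f t ≡ g t) → segment f i m ≡ segment g i m
segment-cong i zero _ = refl
segment-cong i (suc m) f≡g = cong₂ _∷_ (f≡g i ≤-refl (m<m+n i z<s))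
  (segment-cong (suc i) m λ t i<t t< → f≡g t (<⇒≤ i<t) (subst (t <_) (sym (+-suc i m)) t<))

segment-false : ∀ {d} i m → (∀ t → i ≤ t → t < i + m → d t ≡ false) → segment d i m ≡ replicate m false
segment-false i zero _ = refl
segment-false i (suc m) d≡false = cong₂ _∷_ (d≡false i ≤-refl (m<m+n i z<s))
  (segment-false (suc i) m λ t i<t t< → d≡false t (<⇒≤ i<t) (subst (t <_) (sym (+-suc i m)) t<))

segment-near-suc : ∀ X i m → segment (near (suc X)) (suc i) m ≡ segment (near X) i m
segment-near-suc X i zero = refl
segment-near-suc X i (suc m) = cong (near X i ∷_) (segment-near-suc X (suc i) m)

segment-near-shift : ∀ p j i m → segment (near (p + j)) (p + i) m ≡ segment (near j) i m
segment-near-shift zero j i m = refl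
segment-near-shift (suc p) j i m = trans (segment-near-suc (p + j) (p + i) m) (segment-near-shift p j i m)

near-far : ∀ X t → 2 + X ≤ t → near X t ≡ false
near-far zero (suc (suc t)) _ = refl
near-far zero (suc zero) (s≤s ())
near-far (suc X) (suc t) (s≤s 2+X≤t) = near-far X t 2+X≤t

record Gap (d : ℕ → Bool) (n p L : ℕ) : Set where
  field
    left   : d p ≡ true
    inside : ∀ t → p < t → t ≤ p + L → d t ≡ false
    right  : d (suc (p + L)) ≡ true
    within : p + L ≤ n

segment-around : ∀ d n p L → p + L ≤ n →
  segment d 0 (suc n) ≡ segment d 0 p ++ d p ∷ segment d (suc p) L ++ segment d (suc (p + L)) (n ∸ (p + L))
segment-around d n p L p+L≤n = begin
  segment d 0 (suc n)                                             ≡⟨ cong (segment d 0) length-split ⟩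
  segment d 0 (p + (suc L + r))                                   ≡⟨ segment-++ d 0 p (suc L + r) ⟩
  segment d 0 p ++ segment d p (suc L + r)                        ≡⟨ cong (segment d 0 p ++_) (segment-++ d p (suc L) r) ⟩
  segment d 0 p ++ segment d p (suc L) ++ segment d (p + suc L) r
    ≡⟨ cong (λ i → segment d 0 p ++ d p ∷ segment d (suc p) L ++ segment d i r) (+-suc p L) ⟩
  segment d 0 p ++ d p ∷ segment d (suc p) L ++ segment d (suc (p + L)) r ∎
  where
  open ≡-Reasoning
  r : ℕ
  r = n ∸ (p + L)
  length-split : suc n ≡ p + (suc L + r)
  length-split = trans (cong suc (sym (m+[n∸m]≡n p+L≤n))) (trans (cong suc (+-assoc p L r)) (sym (+-suc p (L + r))))

headTrue-segment : ∀ d i m → d i ≡ true → HeadTrue (segment d i m)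
headTrue-segment d i zero _ = tt
headTrue-segment d i (suc m) di≡true = di≡true

gap-of-runs : ∀ {d N L} m i p k → i ≡ suc (p + k) → i + m ≡ suc N →
  d p ≡ true → (∀ t → p < t → t ≤ p + k → d t ≡ false) → d (suc N) ≡ true →
  L ∈ runs (segment d i m) k → Σ ℕ λ q → Gap d N q L
gap-of-runs {d} zero _ p k refl i+0≡1+N dp free dN (here refl) =
  p , record { left = dp ; inside = free ; right = subst (λ x → d x ≡ true) (sym i≡1+N) dN
             ; within = ≤-reflexive (suc-injective i≡1+N) }
  where
  i≡1+N : suc (p + k) ≡ suc _
  i≡1+N = trans (sym (+-identityʳ _)) i+0≡1+N
gap-of-runs {d} (suc m) i p k refl i+m≡1+N dp free dN L∈ with d i in di | L∈
... | true | here refl = p , record { left = dp ; inside = free ; right = di ; within = ≤-pred (m+n≤o⇒m≤o i (≤-reflexive i+m≡1+N)) }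
... | true | there L∈′ = gap-of-runs m (suc i) i 0 (cong suc (sym (+-identityʳ i))) (trans (sym (+-suc i m)) i+m≡1+N) di
      (λ t i<t t≤i+0 → ⊥-elim (<⇒≱ i<t (≤-trans t≤i+0 (≤-reflexive (+-identityʳ i))))) dN L∈′
... | false | L∈′ = gap-of-runs m (suc i) p (suc k) (cong suc (sym (+-suc p k))) (trans (sym (+-suc i m)) i+m≡1+N) dp free′ dN L∈′
  where
  free′ : ∀ t → p < t → t ≤ p + suc k → d t ≡ false
  free′ t p<t t≤ with t ≤? p + k
  ... | yes t≤p+k = free t p<t t≤p+k
  ... | no t≰p+k = subst (λ x → d x ≡ false) (sym (≤-antisym (≤-trans t≤ (≤-reflexive (+-suc p k))) (≰⇒> t≰p+k))) di

gap-of-run : ∀ {d n L} → d 0 ≡ true → d (suc n) ≡ true → L ∈ runs (segment d 0 (suc n)) 0 → 1 ≤ L →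
  Σ ℕ λ p → Gap d n p L
gap-of-run {d} {n} d0 dn L∈ 1≤L with d 0 | d0 | L∈
... | true | refl | here refl = contradiction 1≤L λ ()
... | true | refl | there L∈′ = gap-of-runs n 1 0 0 refl refl d0 (λ t 0<t t≤0 → ⊥-elim (<⇒≱ 0<t t≤0)) dn L∈′

last-true-before : ∀ {d : ℕ → Bool} Y → d 0 ≡ true → d Y ≡ false →
  Σ ℕ λ p → p < Y × d p ≡ true × (∀ t → p < t → t ≤ Y → d t ≡ false)
last-true-before {d} zero d0 dY = contradiction (trans (sym d0) dY) λ ()
last-true-before {d} (suc Y) d0 dY with d Y in dY′
... | true = Y , ≤-refl , dY′ , λ t Y<t t≤ → subst (λ x → d x ≡ false) (≤-antisym Y<t t≤) dY
... | false with last-true-before Y d0 dY′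
...   | p , p<Y , dp , free = p , m<n⇒m<1+n p<Y , dp , free′
  where
  free′ : ∀ t → p < t → t ≤ suc Y → d t ≡ false
  free′ t p<t t≤ with t ≤? Y
  ... | yes t≤Y = free t p<t t≤Y
  ... | no t≰Y = subst (λ x → d x ≡ false) (≤-antisym (≰⇒> t≰Y) t≤) dY

first-true-after : ∀ {d : ℕ → Bool} k Y → d (suc (Y + k)) ≡ true → d Y ≡ false →
  Σ ℕ λ q → Y ≤ q × q ≤ Y + k × d (suc q) ≡ true × (∀ t → Y ≤ t → t ≤ q → d t ≡ false)
first-true-after {d} k Y dE dY with d (suc Y) in dY′
... | true = Y , ≤-refl , m≤m+n Y k , dY′ , λ t Y≤t t≤Y → subst (λ x → d x ≡ false) (≤-antisym Y≤t t≤Y) dY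
first-true-after {d} zero Y dE dY | false = contradiction (trans (sym dE) (trans (cong (d ∘ suc) (+-identityʳ Y)) dY′)) λ ()
first-true-after {d} (suc k) Y dE dY | false with first-true-after k (suc Y) (subst (λ x → d (suc x) ≡ true) (+-suc Y k) dE) dY′
... | q , Y<q , q≤ , dq , free = q , <⇒≤ Y<q , ≤-trans q≤ (≤-reflexive (sym (+-suc Y k))) , dq , free′
  where
  free′ : ∀ t → Y ≤ t → t ≤ q → d t ≡ false
  free′ t Y≤t t≤q with Y ≟ t
  ... | yes refl = dY
  ... | no Y≢t = free t (≤∧≢⇒< Y≤t Y≢t) t≤q

gap-around : ∀ {d n Y} → d 0 ≡ true → d (suc n) ≡ true → d Y ≡ false → Y ≤ n →
  Σ ℕ λ p → Σ ℕ λ L → Gap d n p L × p < Y × Y ≤ p + L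
gap-around {d} {n} {Y} d0 dn dY Y≤n with last-true-before Y d0 dY
  | first-true-after (n ∸ Y) Y (subst (λ x → d (suc x) ≡ true) (sym (m+[n∸m]≡n Y≤n)) dn) dY
... | p , p<Y , dp , free-left | q , Y≤q , q≤ , dq , free-right =
  p , q ∸ p , gap , p<Y , ≤-trans Y≤q (≤-reflexive (sym p+L≡q))
  where
  p+L≡q : p + (q ∸ p) ≡ q
  p+L≡q = m+[n∸m]≡n (≤-trans (<⇒≤ p<Y) Y≤q)
  gap : Gap d n p (q ∸ p)
  gap = record
    { left = dp
    ; inside = λ t p<t t≤ → case t ≤? Y of λ
        { (yes t≤Y) → free-left t p<t t≤Y
        ; (no t≰Y) → free-right t (<⇒≤ (≰⇒> t≰Y)) (≤-trans t≤ (≤-reflexive p+L≡q)) }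
    ; right = subst (λ x → d (suc x) ≡ true) (sym p+L≡q) dq
    ; within = subst (_≤ n) (sym p+L≡q) (≤-trans q≤ (≤-reflexive (m+[n∸m]≡n Y≤n)))
    }

near-range : ∀ {X Y p L} → near X Y ≡ true → p < Y → Y ≤ p + L → p ≤ X × X ≤ suc (p + L)
near-range {X} {Y} close p<Y Y≤ with near-sound X Y close
... | inj₁ refl = <⇒≤ p<Y , m≤n⇒m≤1+n Y≤
... | inj₂ (inj₁ refl) = ≤-pred p<Y , ≤-trans (n≤1+n X) (m≤n⇒m≤1+n Y≤)
... | inj₂ (inj₂ refl) = m≤n⇒m≤1+n (<⇒≤ p<Y) , s≤s Y≤

adjacent-near : ∀ {Y W} → W ≡ suc Y ⊎ Y ≡ suc W → near W Y ≡ true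
adjacent-near {Y} {W} (inj₁ W≡1+Y) = near-complete W Y (inj₂ (inj₂ W≡1+Y))
adjacent-near {Y} {W} (inj₂ Y≡1+W) = near-complete W Y (inj₂ (inj₁ Y≡1+W))

free-in-gap : ∀ {d n p L W} → Gap d n p L → d W ≡ false → p ≤ W → W ≤ suc (p + L) → p < W × W ≤ p + L
free-in-gap {d} {W = W} gap free p≤W W≤ = ≤∧≢⇒< p≤W (λ { refl → true≢false (trans (sym left) free) }) ,
  ≤-pred (≤∧≢⇒< W≤ λ { refl → true≢false (trans (sym right) free) })
  where
  open Gap gap
  true≢false : true ≢ false
  true≢false ()

two-cells : ∀ {p L Y W} → p < Y → Y ≤ p + L → p < W → W ≤ p + L → W ≡ suc Y ⊎ Y ≡ suc W → 2 ≤ L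
two-cells {p} {L} p<Y _ _ W≤ (inj₁ refl) = +-cancelˡ-≤ p 2 L (≤-trans (≤-reflexive (+-comm p 2)) (≤-trans (s≤s p<Y) W≤))
two-cells {p} {L} _ Y≤ p<W _ (inj₂ refl) = +-cancelˡ-≤ p 2 L (≤-trans (≤-reflexive (+-comm p 2)) (≤-trans (s≤s p<W) Y≤))

near-cell : ∀ {p L X} → 1 ≤ L → p ≤ X → X ≤ suc (p + L) → Σ ℕ λ Y → p < Y × Y ≤ p + L × near X Y ≡ true
near-cell {p} {L} {X} 1≤L p≤X X≤ with X ≤? p | X ≤? p + L
... | yes X≤p | _ = suc X , s≤s p≤X , ≤-trans (s≤s X≤p) (m<m+n p 1≤L) , near-complete X (suc X) (inj₂ (inj₁ refl))
... | no X≰p | yes X≤p+L = X , ≰⇒> X≰p , X≤p+L , near-complete X X (inj₁ refl)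
... | no _ | no X≰p+L = p + L , m<m+n p 1≤L , ≤-refl , near-complete X (p + L) (inj₂ (inj₂ (≤-antisym X≤ (≰⇒> X≰p+L))))

neighbour-cell : ∀ {p L Y} → 2 ≤ L → p < Y → Y ≤ p + L → Σ ℕ λ W → p < W × W ≤ p + L × (W ≡ suc Y ⊎ Y ≡ suc W)
neighbour-cell {p} {L} {Y} 2≤L p<Y Y≤ with suc Y ≤? p + L
... | yes 1+Y≤ = suc Y , m<n⇒m<1+n p<Y , 1+Y≤ , inj₁ refl
neighbour-cell {p} {L} {suc W} 2≤L p<Y Y≤ | no 1+Y≰ = W , p<W , ≤-trans (n≤1+n W) Y≤ , inj₂ refl
  where
  p<W : p < W
  p<W = ≤-pred (≤-trans (≤-reflexive (+-comm 2 p)) (≤-trans (+-monoʳ-≤ p 2≤L) (≤-pred (≰⇒> 1+Y≰))))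

-- w 0 ≡ 0 makes the empty blocks between adjacent dominated cells irrelevant.
module GapSum (w : ℕ → ℕ) (w0 : w 0 ≡ 0) where

  gapSum : List Bool → ℕ
  gapSum l = sum (map w (runs l 0))

  gapSum-++-true : ∀ A B → gapSum (A ++ true ∷ B) ≡ gapSum A + gapSum B
  gapSum-++-true A B = trans (cong (sum ∘ map w) (runs-++-true A B 0))
    (trans (cong sum (map-++ w (runs A 0) _)) (sum-++ (map w (runs A 0)) (map w (runs B 0))))

  runs-HeadTrue : ∀ C k → HeadTrue C → sum (map w (runs C k)) ≡ w k + gapSum C
  runs-HeadTrue [] k _ = cong (λ x → w k + (x + 0)) (sym w0)
  runs-HeadTrue (true ∷ C) k refl = cong (λ x → w k + (x + gapSum C)) (sym w0)

  gapSum-block : ∀ L C → HeadTrue C → gapSum (replicate L false ++ C) ≡ w L + gapSum C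
  gapSum-block L C hc = trans (cong (sum ∘ map w) (runs-replicate L C 0))
    (trans (runs-HeadTrue C (L + 0) hc) (cong (λ m → w m + gapSum C) (+-identityʳ L)))

  gapSum-after-near : ∀ j i L C → 2 + j ≤ i → HeadTrue C → gapSum (segment (near j) i L ++ C) ≡ w L + gapSum C
  gapSum-after-near j i L C 2+j≤i hc =
    trans (cong (λ l → gapSum (l ++ C)) (segment-false i L λ t i≤t _ → near-far j t (≤-trans 2+j≤i i≤t))) (gapSum-block L C hc)

  gapSum-near : ∀ j L k C → j ≤ suc L → HeadTrue C →
    sum (map w (runs (segment (near j) 1 L ++ C) k)) ≡ w (k + (j ∸ 2)) + (w (L ∸ suc j) + gapSum C)
  gapSum-near 0 0 k C _ hc rewrite +-identityʳ k | w0 = runs-HeadTrue C k hc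
  gapSum-near 0 (suc L) k C _ hc rewrite +-identityʳ k = cong (w k +_) (gapSum-after-near 0 2 L C ≤-refl hc)
  gapSum-near 1 0 k C _ hc rewrite +-identityʳ k | w0 = runs-HeadTrue C k hc
  gapSum-near 1 1 k C _ hc rewrite +-identityʳ k | w0 = refl
  gapSum-near 1 (suc (suc L)) k C _ hc rewrite +-identityʳ k | w0 = cong (w k +_) (gapSum-after-near 1 3 L C ≤-refl hc)
  gapSum-near 2 0 k C (s≤s ()) hc
  gapSum-near 2 1 k C _ hc rewrite +-identityʳ k | w0 = refl
  gapSum-near 2 2 k C _ hc rewrite +-identityʳ k | w0 = refl
  gapSum-near 2 (suc (suc (suc L))) k C _ hc rewrite +-identityʳ k | w0 = cong (w k +_) (gapSum-after-near 2 4 L C ≤-refl hc)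
  gapSum-near (suc (suc (suc j))) 0 k C (s≤s ()) hc
  gapSum-near (suc (suc (suc j))) (suc L) k C (s≤s j≤L) hc =
    trans (cong (λ l → sum (map w (runs (l ++ C) (suc k)))) (segment-near-suc (2 + j) 1 L))
    (trans (gapSum-near (suc (suc j)) L (suc k) C j≤L hc) (cong (λ m → w m + (w (L ∸ suc (suc (suc j))) + gapSum C)) (sym (+-suc k j))))

  module _ {d n p L} (gap : Gap d n p L) where
    open Gap gap

    before after : ℕ
    before = gapSum (segment d 0 p)
    after = gapSum (segment d (suc (p + L)) (n ∸ (p + L)))

    gapSum-gap : gapSum (segment d 0 (suc n)) ≡ before + (w L + after)
    gapSum-gap = begin
      gapSum (segment d 0 (suc n))                               ≡⟨ cong gapSum (segment-around d n p L within) ⟩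
      gapSum (segment d 0 p ++ d p ∷ segment d (suc p) L ++ C)
        ≡⟨ cong (λ b → gapSum (segment d 0 p ++ b ∷ segment d (suc p) L ++ C)) left ⟩
      gapSum (segment d 0 p ++ true ∷ segment d (suc p) L ++ C)  ≡⟨ gapSum-++-true (segment d 0 p) _ ⟩
      before + gapSum (segment d (suc p) L ++ C)
        ≡⟨ cong (λ l → before + gapSum (l ++ C)) (segment-false (suc p) L λ t p<t t< → inside t p<t (≤-pred t<)) ⟩
      before + gapSum (replicate L false ++ C)                   ≡⟨ cong (before +_) (gapSum-block L C (headTrue-segment d _ _ right)) ⟩
      before + (w L + after)                                     ∎
      where
      open ≡-Reasoning
      C : List Bool
      C = segment d (suc (p + L)) (n ∸ (p + L))

    gapSum-move : ∀ X j → X ≡ p + j → j ≤ suc L →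
      (∀ t → t ≤ p ⊎ suc (p + L) ≤ t → near X t ≡ true → d t ≡ true) →
      gapSum (segment (λ t → d t ∨ near X t) 0 (suc n)) ≡ before + (w (j ∸ 2) + (w (L ∸ suc j) + after))
    gapSum-move X j X≡p+j j≤1+L outside = begin
      gapSum (segment d′ 0 (suc n))                                    ≡⟨ cong gapSum (segment-around d′ n p L within) ⟩
      gapSum (segment d′ 0 p ++ d′ p ∷ segment d′ (suc p) L ++ C′)
        ≡⟨ cong gapSum (cong₂ _++_ (unchanged 0 p λ t _ t<p → inj₁ (<⇒≤ t<p)) (cong₂ _∷_ (unchanged-at (inj₁ ≤-refl))
             (cong₂ _++_ covered (unchanged (suc (p + L)) (n ∸ (p + L)) λ t ≤t _ → inj₂ ≤t)))) ⟩
      gapSum (segment d 0 p ++ d p ∷ segment (near X) (suc p) L ++ C)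
        ≡⟨ cong (λ b → gapSum (segment d 0 p ++ b ∷ segment (near X) (suc p) L ++ C)) left ⟩
      gapSum (segment d 0 p ++ true ∷ segment (near X) (suc p) L ++ C) ≡⟨ gapSum-++-true (segment d 0 p) _ ⟩
      before + gapSum (segment (near X) (suc p) L ++ C)                ≡⟨ cong (λ l → before + gapSum (l ++ C)) shift ⟩
      before + gapSum (segment (near j) 1 L ++ C)
        ≡⟨ cong (before +_) (gapSum-near j L 0 C j≤1+L (headTrue-segment d _ _ right)) ⟩
      before + (w (j ∸ 2) + (w (L ∸ suc j) + after))                   ∎
      where
      open ≡-Reasoning
      d′ : ℕ → Bool
      d′ t = d t ∨ near X t
      C C′ : List Bool
      C = segment d (suc (p + L)) (n ∸ (p + L))
      C′ = segment d′ (suc (p + L)) (n ∸ (p + L))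
      unchanged-at : ∀ {t} → t ≤ p ⊎ suc (p + L) ≤ t → d′ t ≡ d t
      unchanged-at {t} out with near X t in eq
      ... | true = trans (∨-zeroʳ (d t)) (sym (outside t out eq))
      ... | false = ∨-identityʳ (d t)
      unchanged : ∀ i m → (∀ t → i ≤ t → t < i + m → t ≤ p ⊎ suc (p + L) ≤ t) → segment d′ i m ≡ segment d i m
      unchanged i m out = segment-cong i m λ t i≤t t< → unchanged-at (out t i≤t t<)
      covered : segment d′ (suc p) L ≡ segment (near X) (suc p) L
      covered = segment-cong (suc p) L λ t p<t t< → cong (_∨ near X t) (inside t p<t (≤-pred t<))
      shift : segment (near X) (suc p) L ≡ segment (near j) 1 L
      shift = trans (cong₂ (λ Y i → segment (near Y) i L) X≡p+j (+-comm 1 p)) (segment-near-shift p j 1 L)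

-- Game values on an arbitrary graph

module _ {m} (G : Graph m) where

  edge-component⇒ : ∀ {S y} → InEdgeComponent G S y → Outside G S y × Σ (Fin m) λ w → Adj G y w × Outside G S w
  edge-component⇒ (_ , v , here oy , _ , ov , adj) = oy , v , adj , ov
  edge-component⇒ (_ , _ , step oy adj (here ow) , _) = oy , _ , adj , ow
  edge-component⇒ (_ , _ , step oy adj (step ow _ _) , _) = oy , _ , adj , ow

  edge-component⇐ : ∀ {S y w} → Outside G S y → Adj G y w → Outside G S w → InEdgeComponent G S y
  edge-component⇐ {y = y} {w} oy adj ow = y , w , here oy , oy , ow , adj

  Prefers-antisym : ∀ p {a b} → Prefers G p a b → Prefers G p b a → a ≡ b
  Prefers-antisym dominator = ≤-antisym
  Prefers-antisym staller b≤a a≤b = ≤-antisym a≤b b≤a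

  GameValue-functional : ∀ f p S {k k′} → GameValue G f p S k → GameValue G f p S k′ → k ≡ k′
  GameValue-functional (suc f) p S (inj₁ (_ , k≡0)) (inj₁ (_ , k′≡0)) = trans k≡0 (sym k′≡0)
  GameValue-functional (suc f) p S (inj₁ (stuck , _)) (inj₂ (x , legal , _)) = contradiction legal (stuck x)
  GameValue-functional (suc f) p S (inj₂ (x , legal , _)) (inj₁ (stuck , _)) = contradiction legal (stuck x)
  GameValue-functional (suc f) p S (inj₂ (x , lx , a , refl , vx , best)) (inj₂ (x′ , lx′ , b , refl , vx′ , best′)) =
    cong suc (Prefers-antisym p (best x′ lx′ b vx′) (best′ x lx a vx))

  value-by-best-move : ∀ {f p S} (V : Fin m → ℕ) →
    (∀ y → Legal G S y → GameValue G f (other G p) (y ∷ S) (V y)) →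
    ∀ y → Legal G S y → (∀ y′ → Legal G S y′ → Prefers G p (V y) (V y′)) →
    GameValue G (suc f) p S (suc (V y))
  value-by-best-move {f} {p} {S} V value y legal best =
    inj₂ (y , legal , V y , refl , value y legal , λ y′ l′ k gv →
      subst (Prefers G p (V y)) (GameValue-functional f (other G p) (y′ ∷ S) (value y′ l′) gv) (best y′ l′))

-- The game on a path

<ᵇ-true : ∀ {m t} → m < t → (m <ᵇ t) ≡ true
<ᵇ-true {zero} {suc t} _ = refl
<ᵇ-true {suc m} {suc t} (s≤s m<t) = <ᵇ-true m<t

<ᵇ-false : ∀ {m t} → t ≤ m → (m <ᵇ t) ≡ false
<ᵇ-false {m} {zero} _ = refl
<ᵇ-false {suc m} {suc t} (s≤s t≤m) = <ᵇ-false t≤m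

module PathGame (n : ℕ) where

  pos : Fin n → ℕ
  pos v = suc (toℕ v)

  -- Cell t of the board stands for vertex t − 1; cell 0 and the cells beyond n are permanently
  -- dominated, so that every component of P_n − N[S] is a Gap between two dominated cells.
  board : List (Fin n) → ℕ → Bool
  board [] t = (t ≡ᵇ 0) ∨ (n <ᵇ t)
  board (x ∷ S) t = board S t ∨ near (pos x) t

  board-mono : ∀ x S {t} → board S t ≡ true → board (x ∷ S) t ≡ true
  board-mono x S e = cong (_∨ _) e

  board-0 : ∀ S → board S 0 ≡ true
  board-0 [] = refl
  board-0 (x ∷ S) = board-mono x S (board-0 S)

  board-beyond : ∀ S {t} → n < t → board S t ≡ true
  board-beyond [] {suc t} n<t = <ᵇ-true n<t
  board-beyond (x ∷ S) n<t = board-mono x S (board-beyond S n<t)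

  board-free : ∀ S {t} → board S t ≡ false → Σ (Fin n) λ v → pos v ≡ t
  board-free S {zero} free = contradiction (trans (sym (board-0 S)) free) λ ()
  board-free S {suc t} free with t <? n
  ... | yes t<n = fromℕ< t<n , cong suc (toℕ-fromℕ< t<n)
  ... | no t≮n = contradiction (trans (sym (board-beyond S (s≤s (≮⇒≥ t≮n)))) free) λ ()

  near⇒adjacent : ∀ s v → near (pos s) (pos v) ≡ true → s ≡ v ⊎ Adj (P n) s v
  near⇒adjacent s v close with near-sound (toℕ s) (toℕ v) close
  ... | inj₁ s≡v = inj₁ (toℕ-injective s≡v)
  ... | inj₂ adj = inj₂ adj

  adjacent⇒near : ∀ s v → s ≡ v ⊎ Adj (P n) s v → near (pos s) (pos v) ≡ true
  adjacent⇒near s v (inj₁ refl) = near-complete (toℕ s) _ (inj₁ refl)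
  adjacent⇒near s v (inj₂ adj) = near-complete (toℕ s) (toℕ v) (inj₂ adj)

  dominated⇒ : ∀ S v → board S (pos v) ≡ true → InClosedNbhd (P n) S v
  dominated⇒ [] v dom = contradiction (trans (sym (<ᵇ-false (toℕ<n v))) dom) λ ()
  dominated⇒ (x ∷ S) v dom with board S (pos v) in old
  ... | true = let (s , s∈S , rel) = dominated⇒ S v old in s , there s∈S , rel
  ... | false = x , here refl , near⇒adjacent x v dom

  dominated⇐ : ∀ S v → InClosedNbhd (P n) S v → board S (pos v) ≡ true
  dominated⇐ (x ∷ S) v (_ , here refl , rel) = trans (cong (board S (pos v) ∨_) (adjacent⇒near x v rel)) (∨-zeroʳ _)
  dominated⇐ (x ∷ S) v (s , there s∈S , rel) = board-mono x S (dominated⇐ S v (s , s∈S , rel))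

  outside⇒free : ∀ S v → Outside (P n) S v → board S (pos v) ≡ false
  outside⇒free S v out with board S (pos v) in dom
  ... | true = contradiction (dominated⇒ S v dom) out
  ... | false = refl

  free⇒outside : ∀ S v → board S (pos v) ≡ false → Outside (P n) S v
  free⇒outside S v free closed = contradiction (trans (sym (dominated⇐ S v closed)) free) λ ()

  near⇒dominated : ∀ x S {t} → near (pos x) t ≡ true → board (x ∷ S) t ≡ true
  near⇒dominated x S {t} close = trans (cong (board S t ∨_) close) (∨-zeroʳ _)

  dominated-neighbour : ∀ S t → board S (suc t) ≡ true → board S t ≡ true ⊎ board S (suc (suc t)) ≡ true
  dominated-neighbour [] t dom with n <? suc (suc t)
  ... | yes n<2+t = inj₂ (board-beyond [] n<2+t)
  ... | no n≮2+t = contradiction (trans (sym (<ᵇ-false (<⇒≤ (≮⇒≥ n≮2+t)))) dom) λ ()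
  dominated-neighbour (x ∷ S) t dom with board S (suc t) in old
  ... | true = Sum.map (board-mono x S) (board-mono x S) (dominated-neighbour S t old)
  ... | false with near-sound (pos x) (suc t) dom
  ...   | inj₁ X≡1+t = inj₁ (near⇒dominated x S (near-complete (pos x) t (inj₂ (inj₂ X≡1+t))))
  ...   | inj₂ (inj₁ 1+t≡1+X) = inj₁ (near⇒dominated x S (near-complete (pos x) t (inj₁ (suc-injective (sym 1+t≡1+X)))))
  ...   | inj₂ (inj₂ X≡2+t) = inj₂ (near⇒dominated x S (near-complete (pos x) (suc (suc t)) (inj₁ X≡2+t)))

  Movable : List (Fin n) → ℕ → Set
  Movable S X = Σ ℕ λ Y → Σ ℕ λ W → board S Y ≡ false × board S W ≡ false × (W ≡ suc Y ⊎ Y ≡ suc W) × near X Y ≡ true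

  legal⇒movable : ∀ S x → Legal (P n) S x → Movable S (pos x)
  legal⇒movable S x (y , component , rel) with edge-component⇒ (P n) component
  ... | out-y , w , adj , out-w =
    pos y , pos w , outside⇒free S y out-y , outside⇒free S w out-w , Sum.map (cong suc) (cong suc) adj , adjacent⇒near x y rel

  movable⇒legal : ∀ S x → Movable S (pos x) → Legal (P n) S x
  movable⇒legal S x (Y , W , free-Y , free-W , adj , close) with board-free S free-Y | board-free S free-W
  ... | y , refl | w , refl =
    y , edge-component⇐ (P n) (free⇒outside S y free-Y) (Sum.map suc-injective suc-injective adj) (free⇒outside S w free-W) ,
    near⇒adjacent x y close

  record Placed (S : List (Fin n)) (x : Fin n) (p L j : ℕ) : Set where
    field
      gap    : Gap (board S) n p L
      long   : 2 ≤ L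
      offset : pos x ≡ p + j
      reach  : j ≤ suc L

    from : p ≤ pos x
    from = subst (p ≤_) (sym offset) (m≤m+n p j)

    to : pos x ≤ suc (p + L)
    to = subst₂ _≤_ (sym offset) (+-suc p L) (+-monoʳ-≤ p reach)

  placed⇒legal : ∀ {S x p L j} → Placed S x p L j → Legal (P n) S x
  placed⇒legal {S} {x} placed =
    let (Y , p<Y , Y≤ , close) = near-cell (≤-trans (s≤s z≤n) long) from to
        (W , p<W , W≤ , adj) = neighbour-cell long p<Y Y≤
    in movable⇒legal S x (Y , W , inside Y p<Y Y≤ , inside W p<W W≤ , adj , close)
    where
    open Placed placed
    open Gap gap

  legal⇒placed : ∀ S x → Legal (P n) S x → Σ ℕ λ p → Σ ℕ λ L → Σ ℕ λ j → Placed S x p L j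
  legal⇒placed S x legal with legal⇒movable S x legal
  ... | Y , W , free-Y , free-W , adj , close with board-free S free-Y
  ... | y , refl with gap-around (board-0 S) (board-beyond S ≤-refl) free-Y (toℕ<n y)
  ... | p , L , gap , p<Y , Y≤ =
    p , L , pos x ∸ p , record
      { gap = gap
      ; long = two-cells p<Y Y≤ p<W W≤ adj
      ; offset = sym (m+[n∸m]≡n (proj₁ x-range))
      ; reach = +-cancelˡ-≤ p _ _ (subst₂ _≤_ (sym (m+[n∸m]≡n (proj₁ x-range))) (sym (+-suc p L)) (proj₂ x-range))
      }
    where
    x-range : p ≤ pos x × pos x ≤ suc (p + L)
    x-range = near-range close p<Y Y≤
    W-cell : p < W × W ≤ p + L
    W-cell = let (p≤W , W≤1+p+L) = near-range (adjacent-near adj) p<Y Y≤ in free-in-gap gap free-W p≤W W≤1+p+L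
    p<W : p < W
    p<W = proj₁ W-cell
    W≤ : W ≤ p + L
    W≤ = proj₂ W-cell

  beyond-left-dominated : ∀ {S p L t} → Gap (board S) n p L → 1 ≤ L → p ≡ suc t → board S t ≡ true
  beyond-left-dominated {S} {p} {L} {t} gap 1≤L refl with dominated-neighbour S t (Gap.left gap)
  ... | inj₁ dom = dom
  ... | inj₂ dom = contradiction (trans (sym dom) (Gap.inside gap (suc p) ≤-refl (m<m+n p 1≤L))) λ ()

  beyond-right-dominated : ∀ {S p L t} → Gap (board S) n p L → 1 ≤ L → t ≡ suc (suc (p + L)) → board S t ≡ true
  beyond-right-dominated {S} {p} {L} {t} gap 1≤L refl with dominated-neighbour S (p + L) (Gap.right gap)
  ... | inj₁ dom = contradiction (trans (sym dom) (Gap.inside gap (p + L) (m<m+n p 1≤L) ≤-refl)) λ ()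
  ... | inj₂ dom = dom

  outside-dominated : ∀ {S p L X} t → Gap (board S) n p L → 1 ≤ L → p ≤ X → X ≤ suc (p + L) →
    t ≤ p ⊎ suc (p + L) ≤ t → near X t ≡ true → board S t ≡ true
  outside-dominated {S} {p} {L} {X} t gap 1≤L p≤X X≤ out close with t ≟ p | t ≟ suc (p + L)
  ... | yes refl | _ = Gap.left gap
  ... | no _ | yes refl = Gap.right gap
  ... | no t≢p | no t≢e with out | near-sound X t close
  ... | inj₁ t≤p | inj₁ refl = ⊥-elim (t≢p (≤-antisym t≤p p≤X))
  ... | inj₁ t≤p | inj₂ (inj₁ refl) = ⊥-elim (<⇒≱ (≤∧≢⇒< t≤p t≢p) (≤-trans p≤X (n≤1+n X)))
  ... | inj₁ t≤p | inj₂ (inj₂ refl) = beyond-left-dominated {S} gap 1≤L (≤-antisym p≤X (≤∧≢⇒< t≤p t≢p))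
  ... | inj₂ e≤t | inj₁ refl = ⊥-elim (t≢e (≤-antisym X≤ e≤t))
  ... | inj₂ e≤t | inj₂ (inj₁ refl) =
    beyond-right-dominated {S} gap 1≤L (cong suc (≤-antisym X≤ (≤-pred (≤∧≢⇒< e≤t (t≢e ∘ sym)))))
  ... | inj₂ e≤t | inj₂ (inj₂ refl) = ⊥-elim (<⇒≱ e≤t (≤-pred X≤))

  initial-gap : Gap (board []) n 0 n
  initial-gap = record
    { left = refl
    ; inside = λ { (suc t) _ t<n → <ᵇ-false t<n }
    ; right = board-beyond [] (n<1+n n)
    ; within = ≤-refl
    }

  module Cost (w : ℕ → ℕ) (w0 : w 0 ≡ 0) where
    open GapSum w w0

    cost : List (Fin n) → ℕ
    cost S = gapSum (segment (board S) 0 (suc n))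

    cost-placed : ∀ {S x p L j} → Placed S x p L j → cost (x ∷ S) + w L ≡ cost S + (w (j ∸ 2) + w (L ∸ suc j))
    cost-placed {S} {x} {p} {L} {j} placed = begin
      cost (x ∷ S) + w L                          ≡⟨ cong (_+ w L) (gapSum-move gap (pos x) j offset reach
                                                       λ t → outside-dominated {S} t gap (≤-trans (s≤s z≤n) long) from to) ⟩
      before gap + (a + (b + after gap)) + w L    ≡⟨ rearrange (before gap) a b (after gap) (w L) ⟩
      before gap + (w L + after gap) + (a + b)    ≡⟨ cong (_+ (a + b)) (sym (gapSum-gap gap)) ⟩
      cost S + (a + b)                            ∎
      where
      open ≡-Reasoning
      open Placed placed
      a b : ℕ
      a = w (j ∸ 2)
      b = w (L ∸ suc j)
      rearrange : ∀ B a b A l → B + (a + (b + A)) + l ≡ B + (l + A) + (a + b)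
      rearrange = solve-∀

    cost-initial : cost [] ≡ w n
    cost-initial = begin
      cost []                                                         ≡⟨ gapSum-gap initial-gap ⟩
      gapSum [] + (w n + gapSum (segment (board []) (suc n) (n ∸ n)))
        ≡⟨ cong (λ m → gapSum [] + (w n + gapSum (segment (board []) (suc n) m))) (n∸n≡0 n) ⟩
      gapSum [] + (w n + gapSum [])                                   ≡⟨ cong₂ (λ z z′ → z + (w n + z′)) gapSum-[] gapSum-[] ⟩
      w n + 0                                                         ≡⟨ +-identityʳ (w n) ⟩
      w n                                                             ∎
      where
      open ≡-Reasoning
      gapSum-[] : gapSum [] ≡ 0
      gapSum-[] = cong (_+ 0) w0

  module Potential = Cost weight refl
  module Free = Cost (λ L → L) refl

  potential free-cells : List (Fin n) → ℕ
  potential = Potential.cost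
  free-cells = Free.cost

  placed-potential : ∀ {S x p L j} → Placed S x p L j → potential (x ∷ S) ⋖ potential S
  placed-potential placed = trade-⋖ (Potential.cost-placed placed) (weight-drop _ _ long reach)
    where open Placed placed

  placed-free-cells : ∀ {S x p L j} → Placed S x p L j → free-cells (x ∷ S) < free-cells S
  placed-free-cells placed = trade-< (Free.cost-placed placed) (split-shrinks (≤-trans (s≤s z≤n) long) reach)
    where open Placed placed

  legal-potential : ∀ {S x} → Legal (P n) S x → potential (x ∷ S) ⋖ potential S
  legal-potential {S} {x} legal = let (_ , _ , _ , placed) = legal⇒placed S x legal in placed-potential placed

  legal-free-cells : ∀ {S x} → Legal (P n) S x → free-cells (x ∷ S) < free-cells S
  legal-free-cells {S} {x} legal = let (_ , _ , _ , placed) = legal⇒placed S x legal in placed-free-cells placed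

  vertex : ∀ {q} → q < n → Σ (Fin n) λ y → pos y ≡ suc q
  vertex q<n = fromℕ< q<n , cong suc (toℕ-fromℕ< q<n)

  least-exponent-gap : ∀ {e} → WeightExponent e → ∀ S →
    potential S ≡ 0 ⊎ Σ ℕ λ p → Σ ℕ λ L → Gap (board S) n p L × 2 ≤ L × 2 ^ e L ∣ potential S
  least-exponent-gap exponent S with least-exponent exponent (runs (segment (board S) 0 (suc n)) 0)
  ... | inj₁ Z≡0 = inj₁ Z≡0
  ... | inj₂ (L , L∈ , 2≤L , 2^e∣Z) =
    let (p , gap) = gap-of-run (board-0 S) (board-beyond S (n<1+n n)) L∈ (≤-trans (s≤s z≤n) 2≤L)
    in inj₂ (p , L , gap , 2≤L , 2^e∣Z)

  dominator-gap-move : ∀ {S p L} → Gap (board S) n p L → 2 ≤ L → Σ (Fin n) λ y → Placed S y p L (L ⊓ 3)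
  dominator-gap-move {S} {p} {L} gap 2≤L =
    let (y , pos-y) = board-free S (Gap.inside gap (p + L ⊓ 3) p<p+j (+-monoʳ-≤ p (m⊓n≤m L 3)))
    in y , record { gap = gap ; long = 2≤L ; offset = pos-y ; reach = m≤n⇒m≤1+n (m⊓n≤m L 3) }
    where
    p<p+j : p < p + L ⊓ 3
    p<p+j = m<m+n p (⊓-glb (≤-trans (s≤s z≤n) 2≤L) (s≤s z≤n))

  -- Staller plays on the dominated end of the gap, whose outer neighbour is dominated too, so only
  -- one cell is covered. A gap starting at cell 0 is attacked from its right end; it cannot reach
  -- the other border, because the cell of x is dominated.
  staller-gap-move : ∀ x S {p L} → Gap (board (x ∷ S)) n p L → 2 ≤ L →
    Σ (Fin n) λ y → Σ ℕ λ j → Placed (x ∷ S) y p L j × weight (j ∸ 2) + weight (L ∸ suc j) ≡ weight (L ∸ 1)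
  staller-gap-move x S {suc p} {L} gap 2≤L =
    let (y , pos-y) = vertex (≤-trans (m≤m+n (suc p) L) (Gap.within gap))
    in y , 0 , record { gap = gap ; long = 2≤L ; offset = trans pos-y (sym (+-identityʳ (suc p))) ; reach = z≤n } , refl
  staller-gap-move x S {zero} {L} gap 2≤L with L <? n
  ... | yes L<n = proj₁ (vertex L<n) , suc L , record { gap = gap ; long = 2≤L ; offset = proj₂ (vertex L<n) ; reach = ≤-refl } ,
        trans (cong (λ m → weight (L ∸ 1) + weight m) (m≤n⇒m∸n≡0 (≤-trans (n≤1+n L) (n≤1+n (suc L))))) (+-identityʳ _)
  ... | no L≮n = contradiction (trans (sym (near⇒dominated x S (near-complete (pos x) _ (inj₁ refl))))
                                     (Gap.inside gap (pos x) z<s (≤-trans (toℕ<n x) (≮⇒≥ L≮n)))) λ ()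

  dominator-move : ∀ S → potential S ≡ 0 ⊎ Σ (Fin n) λ y → Legal (P n) S y × suc ⌈ potential (y ∷ S) /8⌉ ≤ potential S / 8
  dominator-move S with least-exponent-gap domExp-exponent S
  ... | inj₁ Z≡0 = inj₁ Z≡0
  ... | inj₂ (p , L , gap , 2≤L , 2^e∣Z) with dominator-gap-move gap 2≤L
  ... | y , placed = inj₂ (y , placed⇒legal placed , good-dominator-move (2^-∣ (long⇒domExp≤3 L 2≤L)) 2^e∣Z drop)
    where
    drop : potential (y ∷ S) + 16 ≤ potential S + 2 ^ domExp L
    drop = trade {a = weight L} {b = weight (L ⊓ 3 ∸ 2) + weight (L ∸ suc (L ⊓ 3))}
      (Potential.cost-placed placed) (dominator-drop L 2≤L)

  staller-move : ∀ x S → potential (x ∷ S) ≡ 0 ⊎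
    Σ (Fin n) λ y → Legal (P n) (x ∷ S) y × ⌈ potential (x ∷ S) /8⌉ ≤ suc (potential (y ∷ x ∷ S) / 8)
  staller-move x S with least-exponent-gap stalExp-exponent (x ∷ S)
  ... | inj₁ Z≡0 = inj₁ Z≡0
  ... | inj₂ (p , L , gap , 2≤L , 2^e∣Z) with staller-gap-move x S gap 2≤L
  ... | y , j , placed , residual = inj₂ (y , placed⇒legal placed , good-staller-move (2^-∣ (long⇒stalExp≤3 L 2≤L)) 2^e∣Z drop)
    where
    drop : potential (x ∷ S) ≤ potential (y ∷ x ∷ S) + 2 ^ stalExp L
    drop = trade-≤ (Potential.cost-placed placed) (subst (λ r → weight L ≤ r + 2 ^ stalExp L) (sym residual) (staller-drop L 2≤L))

  stuck : ∀ {S} → potential S ≡ 0 → ∀ x → ¬ Legal (P n) S x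
  stuck {S} Z≡0 x legal = contradiction (subst (potential (x ∷ S) <_) Z≡0 (proj₁ (legal-potential legal))) λ ()

  -- The number of free cells bounds the length of the rest of the game, so it can serve as the
  -- depth bound of GameValue.
  mutual
    dominator-value : ∀ f S → free-cells S < f → GameValue (P n) f dominator S (potential S / 8)
    dominator-value (suc f) S fuel with dominator-move S
    ... | inj₁ Z≡0 = inj₁ (stuck Z≡0 , cong (_/ 8) Z≡0)
    ... | inj₂ (y , legal , good) =
      subst (GameValue (P n) (suc f) dominator S) (≤-antisym good (any-move-floor (proj₂ (legal-potential legal))))
        (value-by-best-move (P n) V next y legal λ y′ l′ → ≤-pred (≤-trans good (any-move-floor (proj₂ (legal-potential l′)))))
      where
      V : Fin n → ℕ
      V y′ = ⌈ potential (y′ ∷ S) /8⌉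
      next : ∀ y′ → Legal (P n) S y′ → GameValue (P n) f staller (y′ ∷ S) (V y′)
      next y′ l′ = staller-value f y′ S (<-≤-trans (legal-free-cells l′) (≤-pred fuel))

    staller-value : ∀ f x S → free-cells (x ∷ S) < f → GameValue (P n) f staller (x ∷ S) ⌈ potential (x ∷ S) /8⌉
    staller-value (suc f) x S fuel with staller-move x S
    ... | inj₁ Z≡0 = inj₁ (stuck Z≡0 , cong ⌈_/8⌉ Z≡0)
    ... | inj₂ (y , legal , good) =
      subst (GameValue (P n) (suc f) staller (x ∷ S)) (≤-antisym (any-move-ceil (proj₁ (legal-potential legal))) good)
        (value-by-best-move (P n) V next y legal λ y′ l′ → ≤-pred (≤-trans (any-move-ceil (proj₁ (legal-potential l′))) good))
      where
      V : Fin n → ℕ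
      V y′ = potential (y′ ∷ x ∷ S) / 8
      next : ∀ y′ → Legal (P n) (x ∷ S) y′ → GameValue (P n) f dominator (y′ ∷ x ∷ S) (V y′)
      next y′ l′ = dominator-value f (y′ ∷ x ∷ S) (<-≤-trans (legal-free-cells l′) (≤-pred fuel))

  initial-placed : 2 ≤ n → ∀ y → Placed [] y 0 n (pos y)
  initial-placed 2≤n y = record { gap = initial-gap ; long = 2≤n ; offset = refl ; reach = s≤s (<⇒≤ (toℕ<n y)) }

  potential-first : 2 ≤ n → ∀ y → potential (y ∷ []) ≡ opening n (toℕ y)
  potential-first 2≤n y = +-cancelʳ-≡ (weight n) _ _ (begin
    potential (y ∷ []) + weight n        ≡⟨ Potential.cost-placed (initial-placed 2≤n y) ⟩
    potential [] + opening n (toℕ y)     ≡⟨ cong (_+ opening n (toℕ y)) Potential.cost-initial ⟩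
    weight n + opening n (toℕ y)         ≡⟨ +-comm (weight n) (opening n (toℕ y)) ⟩
    opening n (toℕ y) + weight n         ∎)
    where open ≡-Reasoning

  ι-dominator-first : IsIotaG (P n) (weight n / 8)
  ι-dominator-first = subst (GameValue (P n) (suc n) dominator []) (cong (_/ 8) Potential.cost-initial)
    (dominator-value (suc n) [] (≤-reflexive (cong suc Free.cost-initial)))

  ι-staller-first : 2 ≤ n → ∀ y → (∀ y′ → potential (y′ ∷ []) / 8 ≤ potential (y ∷ []) / 8) →
    IsIotaG′ (P n) (suc (potential (y ∷ []) / 8))
  ι-staller-first 2≤n y best =
    value-by-best-move (P n) (λ y′ → potential (y′ ∷ []) / 8) next y (placed⇒legal (initial-placed 2≤n y)) λ y′ _ → best y′
    where
    next : ∀ y′ → Legal (P n) [] y′ → GameValue (P n) n dominator (y′ ∷ []) (potential (y′ ∷ []) / 8)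
    next y′ l′ = dominator-value n (y′ ∷ []) (subst (free-cells (y′ ∷ []) <_) Free.cost-initial (legal-free-cells l′))

  first-move-bound : 2 ≤ n → ∀ y → suc (potential (y ∷ []) / 8) ≤ (2 * n + 2) / 5
  first-move-bound 2≤n y = subst (λ Z → suc (Z / 8) ≤ (2 * n + 2) / 5) (sym (potential-first 2≤n y))
    (opening-bound n (toℕ y) 2≤n (toℕ<n y))

  best-first-move : 6 ≤ n → Σ (Fin n) λ y → (2 * n + 2) / 5 ≤ suc (potential (y ∷ []) / 8)
  best-first-move 6≤n = pick (best-opening n 6≤n)
    where
    pick : Σ ℕ (λ t → t < n × (2 * n + 2) / 5 ≤ suc (opening n t / 8)) →
           Σ (Fin n) λ y → (2 * n + 2) / 5 ≤ suc (potential (y ∷ []) / 8)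
    pick (t , t<n , U≤) = fromℕ< t<n , subst (λ Z → (2 * n + 2) / 5 ≤ suc (Z / 8))
      (sym (trans (potential-first (≤-trans (s≤s (s≤s z≤n)) 6≤n) (fromℕ< t<n)) (cong (opening n) (toℕ-fromℕ< t<n)))) U≤

corollary4p5 : (n : ℕ) → 6 ≤ n →
    Σ ℕ λ k → Σ ℕ λ k′ →
      IsIotaG (P n) k × IsIotaG′ (P n) k′ ×
      ((2 * n + 4) / 5) ∸ 1 ≤ k × k ≤ k′ × k′ ≤ (2 * n + 2) / 5
corollary4p5 n 6≤n =
  let (y , U≤) = best-first-move 6≤n in
  weight n / 8 , suc (potential (y ∷ []) / 8) ,
  ι-dominator-first , ι-staller-first 2≤n y (λ y′ → ≤-pred (≤-trans (first-move-bound 2≤n y′) U≤)) ,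
  weight-lower n , ≤-trans (weight-upper n) U≤ , first-move-bound 2≤n y
  where
  open PathGame n
  2≤n : 2 ≤ n
  2≤n = ≤-trans (s≤s (s≤s z≤n)) 6≤n
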